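{- (i) For every rooted binary phylogenetic $X$-tree $T$ with $n=|X|\ge 3$ leaves, there exists a set $R_T$ of $n-2$ rooted triples such that (a) $T$ is the only rooted phylogenetic $X$-tree that displays every triple in $R_T$, and (b) $\|R_T\|$ is thin. (ii) For every $n\ge 6$ there exist a set $X$ with $|X|=n$ and a phylogenetically flexible set $\tau\subseteq\binom{X}{3}$ with $|\tau|=n-2$ such that, for every choice of one rooted triple with leaf set $s$ for each $s\in\tau$, the resulting set of rooted triples is displayed by more than one rooted phylogenetic $X$-tree.
   Context: A rooted phylogenetic $X$-tree is a rooted tree with labelled leaf set $X$ whose non-leaf vertices are unlabelled with out-degree at least 2; binary means all non-leaf vertices have out-degree exactly 2. A rooted triple $ab|c$ is the rooted binary tree on $\{a,b,c\}$ with $c$ adjacent to the root; a tree displays it if it contains a subdivision of it as a subgraph. For a set $R$ of rooted triples, $\|R\|$ is the collection of their leaf sets. With $L(\tau)=\bigcup_{s\in\tau}s$, a non-empty $\tau\subseteq\binom{X}{3}$ is thin if $|L(\tau')|\ge|\tau'|+2$ for all non-empty $\tau'\subseteq\tau$, and phylogenetically flexible if for every choice of one rooted triple with leaf set $s$ for each $s\in\tau$ some rooted phylogenetic $X$-tree displays all chosen triples. -}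

module Defs where

open import Data.Nat using (ℕ; zero; suc; _+_; _≤_; _<_; _∸_)
open import Data.Fin using (Fin)
open import Data.Fin.Permutation using (Permutation′; _⟨$⟩ʳ_)
import Data.Fin.Subset as S
open import Data.Fin.Subset using (Subset; ∣_∣; Nonempty; ⁅_⁆; _∪_; ⋃)
open import Data.Bool using (if_then_else_)
open import Data.List using (List; []; _∷_; _++_; length; tabulate; lookup)
import Data.List.Membership.Propositional as LM
open import Data.List.Relation.Unary.All using (All)
open import Data.List.Relation.Unary.AllPairs using (AllPairs)
open import Data.List.Relation.Unary.Unique.Propositional using (Unique)
open import Data.Vec using (Vec; []; _∷_)
import Data.Vec as V
import Data.Vec.Membership.Propositional as VM
open import Data.Product using (Σ; ∃; _×_; _,_; proj₁)
open import Data.Sum using (_⊎_)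
open import Relation.Binary.PropositionalEquality using (_≡_; _≢_)
open import Relation.Nullary using (¬_)
open import Function.Bundles using (_⇔_)

-- The leaf set X is Fin n.
-- A rooted phylogenetic tree (shape): a leaf labelled by an element of X,
-- or an unlabelled internal vertex with k+2 ≥ 2 children (ordered only for
-- representation; order is quotiented out by ≅ below).
data Tree (n : ℕ) : Set where
  leaf : Fin n → Tree n
  node : {k : ℕ} → Vec (Tree n) (suc (suc k)) → Tree n

module _ {n : ℕ} where

  mutual
    leaves : Tree n → List (Fin n)
    leaves (leaf x) = x ∷ []
    leaves (node ts) = leavesV ts

    leavesV : {m : ℕ} → Vec (Tree n) m → List (Fin n)
    leavesV [] = []
    leavesV (t ∷ ts) = leaves t ++ leavesV ts

  PhyloTree : Tree n → Set
  PhyloTree T = Unique (leaves T) × (∀ x → x LM.∈ leaves T)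

  data Binary : Tree n → Set where
    leaf : (x : Fin n) → Binary (leaf x)
    node : {l r : Tree n} → Binary l → Binary r → Binary (node (l ∷ r ∷ []))

  -- isomorphism of rooted trees preserving leaf labels
  -- (children may be permuted); this is equality of phylogenetic X-trees
  data _≅_ : Tree n → Tree n → Set where
    leaf : (x : Fin n) → leaf x ≅ leaf x
    node : {k : ℕ} {ts us : Vec (Tree n) (suc (suc k))}
           (π : Permutation′ (suc (suc k))) →
           (∀ i → V.lookup ts i ≅ V.lookup us (π ⟨$⟩ʳ i)) →
           node ts ≅ node us

  -- v ⊑ T : v is (the subtree below) a vertex of T
  data _⊑_ : Tree n → Tree n → Set where
    here  : {t : Tree n} → t ⊑ t
    child : {v t : Tree n} {k : ℕ} {ts : Vec (Tree n) (suc (suc k))} →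
            v ⊑ t → t VM.∈ ts → v ⊑ node ts

  record Triple : Set where
    constructor _∣∣_∣_
    field
      a b c : Fin n

  open Triple public

  ValidTriple : Triple → Set
  ValidTriple t = (a t ≢ b t) × (a t ≢ c t) × (b t ≢ c t)

  SameTriple : Triple → Triple → Set
  SameTriple t u = (c t ≡ c u) ×
    (((a t ≡ a u) × (b t ≡ b u)) ⊎ ((a t ≡ b u) × (b t ≡ a u)))

  leafSet : Triple → Subset n
  leafSet t = ⁅ a t ⁆ ∪ (⁅ b t ⁆ ∪ ⁅ c t ⁆)

  -- T displays ab|c: some vertex v of T has a and b below it but not c
  -- (this is exactly the existence of a subdivision of ab|c in T:
  --  v is the image of the cherry vertex)
  Displays : Tree n → Triple → Set
  Displays T t = Σ (Tree n) λ v → v ⊑ T ×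
    (a t LM.∈ leaves v) × (b t LM.∈ leaves v) × ¬ (c t LM.∈ leaves v)

  DisplaysAll : Tree n → List Triple → Set
  DisplaysAll T R = All (Displays T) R

  -- a finite set of rooted triples, as a duplicate-free list
  TripleSet : List Triple → Set
  TripleSet R = All ValidTriple R × AllPairs (λ t u → ¬ SameTriple t u) R

  -- a finite set of 3-subsets of X, as a duplicate-free list
  ThreeSets : List (Subset n) → Set
  ThreeSets τ = All (λ s → ∣ s ∣ ≡ 3) τ × Unique τ

  -- L(τ') for the sub-collection τ' of τ selected by σ
  Lsel : (τ : List (Subset n)) → Subset (length τ) → Subset n
  Lsel τ σ = ⋃ (tabulate (λ i → if V.lookup σ i then lookup τ i else S.⊥))

  Thin : List (Subset n) → Set
  Thin τ = (0 < length τ) ×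
    ((σ : Subset (length τ)) → Nonempty σ → ∣ σ ∣ + 2 ≤ ∣ Lsel τ σ ∣)

  ThinLeafSets : List Triple → Set
  ThinLeafSets R = Σ (List (Subset n)) λ τ → Unique τ ×
    (∀ s → (s LM.∈ τ) ⇔ (∃ λ t → t LM.∈ R × leafSet t ≡ s)) × Thin τ

  Choice : List (Subset n) → Set
  Choice τ = (i : Fin (length τ)) →
    Σ Triple λ t → ValidTriple t × leafSet t ≡ lookup τ i

  chosen : (τ : List (Subset n)) → Choice τ → List Triple
  chosen τ f = tabulate (λ i → proj₁ (f i))

  PhylogeneticallyFlexible : List (Subset n) → Set
  PhylogeneticallyFlexible τ = (0 < length τ) × ((f : Choice τ) →
    Σ (Tree n) λ T → PhyloTree T × DisplaysAll T (chosen τ f))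

Part-i : Set
Part-i = (n : ℕ) → 3 ≤ n → (T : Tree n) → PhyloTree T → Binary T →
  Σ (List (Triple {n})) λ R → TripleSet R × length R ≡ n ∸ 2 ×
    DisplaysAll T R ×
    ((T′ : Tree n) → PhyloTree T′ → DisplaysAll T′ R → T′ ≅ T) ×
    ThinLeafSets R

Part-ii : Set
Part-ii = (n : ℕ) → 6 ≤ n →
  Σ (List (Subset n)) λ τ → ThreeSets τ × length τ ≡ n ∸ 2 ×
    PhylogeneticallyFlexible τ ×
    ((f : Choice τ) → Σ (Tree n) λ T₁ → Σ (Tree n) λ T₂ →
       PhyloTree T₁ × PhyloTree T₂ ×
       DisplaysAll T₁ (chosen τ f) × DisplaysAll T₂ (chosen τ f) × ¬ (T₁ ≅ T₂))

{-# OPTIONS --safe #-}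
-- (i) Write ṫ for the leftmost leaf of a subtree t. For a binary tree T, R_T consists of the
-- triples l̇ṙ|ṡ, one for every non-root internal vertex with children l, r and sibling s, so
-- |R_T| = n − 2. If T′ displays R_T then, by induction on a subtree S with outgroup z, some
-- vertex of T′ contains every leaf of S but not z. Applied to the two sides of the root of T,
-- this forces the root of T′ to have exactly two children carrying the leaf sets of those
-- sides, and induction gives T′ ≅ T. Listed bottom-up, the middle leaf ṙ of each triple occurs
-- in no later triple; so in any subcollection τ′ every triple but the last adds a new leaf to
-- the three of the last one, and |L(τ′)| ≥ |τ′| + 2.
--
-- (ii) Take X = {x₀, x₁} ∪ Y with |Y| = n − 2 ≥ 4 and τ = {{x₀, x₁, y} | y ∈ Y}. A choice of
-- triples sorts Y into the leaves y with x₀y|x₁, with x₁y|x₀ and with x₀x₁|y. Hanging the first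
-- two groups as caterpillars below x₀ and x₁, joining them in a cherry and hanging the third
-- group above it gives a binary tree displaying the choice. By pigeonhole some group has two
-- leaves; attaching both at one vertex of out-degree 3 gives a second, non-binary tree that
-- still displays every chosen triple.

module Submission where

open import Defs
open import Data.Bool using (if_then_else_)
open import Data.Empty using (⊥-elim)
open import Data.Fin using (Fin; zero; suc; cast)
open import Data.Fin.Permutation using (id; transpose; inverseʳ; _⟨$⟩ˡ_)
open import Data.Fin.Properties
  using (injective⇒≤; pigeonhole; cast-involutive; <⇒≢) renaming (_≟_ to _≟ᶠ_)
open import Data.Fin.Subset as Subset using (Subset; ∣_∣; ⁅_⁆; _∪_; Nonempty; inside; outside)
open import Data.Fin.Subset.Properties
  using (p⊂q⇒∣p∣<∣q∣; q⊆p∪q; ∣p∣≤∣p∪q∣; x∈p∪q⁺; x∈p∪q⁻; x∈⁅x⁆; x∈⁅y⁆⇒x≡y; ∣⁅x⁆∣≡1; ∉⊥;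
         nonempty?; Empty-unique; ∣⊥∣≡0; ∪-identityˡ)
open import Data.List using (List; []; _∷_; _++_; length; map; filter; tabulate)
import Data.List as List
open import Data.List.Membership.Propositional using (_∈_; _∉_)
open import Data.List.Membership.Propositional.Properties
  using (∈-++⁺ˡ; ∈-++⁺ʳ; ∈-++⁻; ∈-map⁺; ∈-map⁻; ∈-lookup; ∈-filter⁺; ∈-tabulate⁺)
open import Data.List.Membership.Setoid.Properties using (index-injective)
open import Data.List.Properties
  using (++-identityʳ; ++-assoc; length-++; length-map; length-tabulate; lookup-tabulate)
open import Data.List.Relation.Binary.Disjoint.Propositional using (Disjoint)
import Data.List.Relation.Binary.Disjoint.Propositional.Properties as Disjoint
open import Data.List.Relation.Binary.Subset.Propositional using (_⊆_)
open import Data.List.Relation.Binary.Subset.Propositional.Properties using (∈-∷⁺ʳ)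
open import Data.List.Relation.Unary.All using (All; []; _∷_)
import Data.List.Relation.Unary.All as All
import Data.List.Relation.Unary.All.Properties as Allₚ
open import Data.List.Relation.Unary.AllPairs using (AllPairs; []; _∷_)
import Data.List.Relation.Unary.AllPairs as AllPairs
import Data.List.Relation.Unary.AllPairs.Properties as AllPairsₚ
open import Data.List.Relation.Unary.Any using (here; there)
open import Data.List.Relation.Unary.Unique.Propositional using (Unique)
import Data.List.Relation.Unary.Unique.Propositional.Properties as Uniqueₚ
open import Data.Nat using (ℕ; zero; suc; _+_; _∸_; _≤_; _<_; z≤n; s≤s)
open import Data.Nat.Properties
  using (+-comm; +-suc; m+n∸n≡m; ≤-trans; ≤-antisym; m<n⇒0<n∸m; module ≤-Reasoning)
open import Data.Product using (Σ; ∃-syntax; _×_; _,_; proj₁; proj₂)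
open import Data.Sum using (_⊎_; inj₁; inj₂; [_,_])
open import Data.Vec using (Vec; []; _∷_; lookup)
import Data.Vec.Base as VecBase
import Data.Vec.Membership.Propositional as Vec
open import Data.Vec.Membership.Propositional.Properties using () renaming (∈-lookup to ∈-lookupᵛ)
import Data.Vec.Relation.Unary.Any as VecAny
open import Data.Vec.Relation.Unary.Any.Properties using (lookup-index)
open import Function using (_∘_)
open import Function.Bundles using (mk⇔)
open import Relation.Binary.Definitions using (DecidableEquality)
open import Relation.Binary.PropositionalEquality
  using (_≡_; _≢_; refl; sym; trans; cong; cong₂; subst; setoid; module ≡-Reasoning)
open import Relation.Nullary using (¬_; yes; no; does)
open import Relation.Nullary.Decidable using (map′)

Unique⇒lookup-injective : ∀ {A : Set} {xs : List A} → Unique xs → ∀ {i j} →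
                          List.lookup xs i ≡ List.lookup xs j → i ≡ j
Unique⇒lookup-injective {xs = _ ∷ _} _ {zero} {zero} _ = refl
Unique⇒lookup-injective {xs = _ ∷ _} (x∉ ∷ _) {zero} {suc j} x≡xⱼ =
  ⊥-elim (All.lookup x∉ (∈-lookup j) x≡xⱼ)
Unique⇒lookup-injective {xs = _ ∷ _} (x∉ ∷ _) {suc i} {zero} xᵢ≡x =
  ⊥-elim (All.lookup x∉ (∈-lookup i) (sym xᵢ≡x))
Unique⇒lookup-injective {xs = _ ∷ _} (_ ∷ u) {suc i} {suc j} xᵢ≡xⱼ =
  cong suc (Unique⇒lookup-injective u xᵢ≡xⱼ)

Unique∧complete⇒length≡ : ∀ {n} {xs : List (Fin n)} → Unique xs → (∀ x → x ∈ xs) → length xs ≡ n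
Unique∧complete⇒length≡ {xs = xs} u complete =
  ≤-antisym (injective⇒≤ (Unique⇒lookup-injective u))
            (injective⇒≤ (index-injective (setoid _) (complete _) (complete _)))

Unique-++⁻ : ∀ {A : Set} (xs : List A) {ys} → Unique (xs ++ ys) →
             Unique xs × Unique ys × Disjoint xs ys
Unique-++⁻ []       u = [] , u , λ ()
Unique-++⁻ (x ∷ xs) (x∉ ∷ u) with Unique-++⁻ xs u
... | uxs , uys , disj = Allₚ.++⁻ˡ xs x∉ ∷ uxs , uys , λ where
  (here refl , y∈ys) → All.lookup x∉ (∈-++⁺ʳ xs y∈ys) refl
  (there y∈xs , y∈ys) → disj (y∈xs , y∈ys)

two-members⇒2≤length : ∀ {A : Set} {x y : A} {xs} → x ∈ xs → y ∈ xs → x ≢ y → 2 ≤ length xs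
two-members⇒2≤length {xs = _ ∷ _ ∷ _} _ _ _ = s≤s (s≤s z≤n)
two-members⇒2≤length (here refl) (here refl) x≢y = ⊥-elim (x≢y refl)

All∧All¬⇒Disjoint : ∀ {A : Set} {P : A → Set} {xs ys} → All P xs → All (¬_ ∘ P) ys → Disjoint xs ys
All∧All¬⇒Disjoint Pxs ¬Pys (x∈xs , x∈ys) = All.lookup ¬Pys x∈ys (All.lookup Pxs x∈xs)

module _ {n : ℕ} where

  private variable
    x y z : Fin n
    k : ℕ
    l r t u v w S T : Tree n
    ts : Vec (Tree n) k

  -- Vertices and leaf sets

  firstLeaf : Tree n → Fin n
  firstLeaf (leaf x) = x
  firstLeaf (node (t ∷ _)) = firstLeaf t

  firstLeaf-∈ : ∀ t → firstLeaf t ∈ leaves t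
  firstLeaf-∈ (leaf x) = here refl
  firstLeaf-∈ (node (t ∷ _)) = ∈-++⁺ˡ (firstLeaf-∈ t)

  ∈-leavesV : t Vec.∈ ts → leaves t ⊆ leavesV ts
  ∈-leavesV (VecAny.here refl) = ∈-++⁺ˡ
  ∈-leavesV {ts = t ∷ _} (VecAny.there t∈ts) = ∈-++⁺ʳ (leaves t) ∘ ∈-leavesV t∈ts

  ⊑-leaves : v ⊑ t → leaves v ⊆ leaves t
  ⊑-leaves here = λ x∈ → x∈
  ⊑-leaves (child v⊑t t∈ts) = ∈-leavesV t∈ts ∘ ⊑-leaves v⊑t

  ⊑-trans : u ⊑ v → v ⊑ w → u ⊑ w
  ⊑-trans u⊑v here = u⊑v
  ⊑-trans u⊑v (child v⊑t t∈ts) = child (⊑-trans u⊑v v⊑t) t∈ts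

  mutual
    leaf-⊑ : x ∈ leaves t → leaf x ⊑ t
    leaf-⊑ {t = leaf _} (here refl) = here
    leaf-⊑ {t = node ts} x∈ with leaf-⊑V ts x∈
    ... | t , t∈ts , x⊑t = child x⊑t t∈ts

    leaf-⊑V : (ts : Vec (Tree n) k) → x ∈ leavesV ts → ∃[ t ] t Vec.∈ ts × leaf x ⊑ t
    leaf-⊑V (t ∷ ts) x∈ with ∈-++⁻ (leaves t) x∈
    ... | inj₁ x∈t = t , VecAny.here refl , leaf-⊑ x∈t
    ... | inj₂ x∈ts with leaf-⊑V ts x∈ts
    ...   | t′ , t′∈ts , x⊑t′ = t′ , VecAny.there t′∈ts , x⊑t′

  Unique-leavesV : t Vec.∈ ts → Unique (leavesV ts) → Unique (leaves t)
  Unique-leavesV {ts = t ∷ _} (VecAny.here refl) u = proj₁ (Unique-++⁻ (leaves t) u)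
  Unique-leavesV {ts = t ∷ _} (VecAny.there t∈ts) u =
    Unique-leavesV t∈ts (proj₁ (proj₂ (Unique-++⁻ (leaves t) u)))

  shared-leaf⇒same-index : (ts : Vec (Tree n) k) → Unique (leavesV ts) → ∀ {i j} →
    x ∈ leaves (lookup ts i) → x ∈ leaves (lookup ts j) → i ≡ j
  shared-leaf⇒same-index (t ∷ ts) u {zero} {zero} _ _ = refl
  shared-leaf⇒same-index (t ∷ ts) u {zero} {suc j} x∈t x∈tⱼ =
    ⊥-elim (proj₂ (proj₂ (Unique-++⁻ (leaves t) u)) (x∈t , ∈-leavesV (∈-lookupᵛ j ts) x∈tⱼ))
  shared-leaf⇒same-index (t ∷ ts) u {suc i} {zero} x∈tᵢ x∈t =
    ⊥-elim (proj₂ (proj₂ (Unique-++⁻ (leaves t) u)) (x∈t , ∈-leavesV (∈-lookupᵛ i ts) x∈tᵢ))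
  shared-leaf⇒same-index (t ∷ ts) u {suc i} {suc j} x∈tᵢ x∈tⱼ =
    cong suc (shared-leaf⇒same-index ts (proj₁ (proj₂ (Unique-++⁻ (leaves t) u))) x∈tᵢ x∈tⱼ)

  shared-leaf⇒same-child : Unique (leavesV ts) → u Vec.∈ ts → v Vec.∈ ts →
                           x ∈ leaves u → x ∈ leaves v → u ≡ v
  shared-leaf⇒same-child {ts = ts} uts u∈ts v∈ts x∈u x∈v =
    trans (lookup-index u∈ts)
          (trans (cong (lookup ts) (shared-leaf⇒same-index ts uts (move u∈ts x∈u) (move v∈ts x∈v)))
                 (sym (lookup-index v∈ts)))
    where
    move : (t∈ts : t Vec.∈ ts) → x ∈ leaves t → x ∈ leaves (lookup ts (VecAny.index t∈ts))
    move t∈ts = subst (λ t → _ ∈ leaves t) (lookup-index t∈ts)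

  ⊑-nested : Unique (leaves T) → u ⊑ T → v ⊑ T → x ∈ leaves u → x ∈ leaves v → u ⊑ v ⊎ v ⊑ u
  ⊑-nested uT here v⊑T _ _ = inj₂ v⊑T
  ⊑-nested uT u⊑T@(child _ _) here _ _ = inj₁ u⊑T
  ⊑-nested uT (child u⊑t t∈ts) (child v⊑t′ t′∈ts) x∈u x∈v
    with refl ← shared-leaf⇒same-child uT t∈ts t′∈ts (⊑-leaves u⊑t x∈u) (⊑-leaves v⊑t′ x∈v) =
    ⊑-nested (Unique-leavesV t∈ts uT) u⊑t v⊑t′ x∈u x∈v

  overlap⇒⊑ : Unique (leaves T) → u ⊑ T → w ⊑ T → x ∈ leaves u → x ∈ leaves w →
              y ∈ leaves w → y ∉ leaves u → u ⊑ w
  overlap⇒⊑ uT u⊑T w⊑T x∈u x∈w y∈w y∉u with ⊑-nested uT u⊑T w⊑T x∈u x∈w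
  ... | inj₁ u⊑w = u⊑w
  ... | inj₂ w⊑u = ⊥-elim (y∉u (⊑-leaves w⊑u y∈w))

  ⊑-inside-child : v ⊑ node ts → y ∈ leaves (node ts) → y ∉ leaves v →
                   ∃[ i ] leaves v ⊆ leaves (lookup ts i)
  ⊑-inside-child here y∈ y∉ = ⊥-elim (y∉ y∈)
  ⊑-inside-child (child v⊑t t∈ts) _ _ =
    VecAny.index t∈ts , subst (λ t → _ ∈ leaves t) (lookup-index t∈ts) ∘ ⊑-leaves v⊑t

  module Cherry (l r : Tree n) where

    leaves-cherry : leaves (node (l ∷ r ∷ [])) ≡ leaves l ++ leaves r
    leaves-cherry = cong (leaves l ++_) (++-identityʳ (leaves r))

    ∈ˡ : leaves l ⊆ leaves (node (l ∷ r ∷ []))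
    ∈ˡ = ∈-++⁺ˡ

    ∈ʳ : leaves r ⊆ leaves (node (l ∷ r ∷ []))
    ∈ʳ = ∈-++⁺ʳ (leaves l) ∘ ∈-++⁺ˡ

    ∈⁻ : x ∈ leaves (node (l ∷ r ∷ [])) → x ∈ leaves l ⊎ x ∈ leaves r
    ∈⁻ = ∈-++⁻ (leaves l) ∘ subst (_ ∈_) leaves-cherry

    Unique⁻ : Unique (leaves (node (l ∷ r ∷ []))) →
              Unique (leaves l) × Unique (leaves r) × Disjoint (leaves l) (leaves r)
    Unique⁻ = Unique-++⁻ (leaves l) ∘ subst Unique leaves-cherry

    firstLeafʳ∉ˡ : Disjoint (leaves l) (leaves r) → firstLeaf r ∉ leaves l
    firstLeafʳ∉ˡ l#r r₁∈l = l#r (r₁∈l , firstLeaf-∈ r)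

    firstLeafˡ∉ʳ : Disjoint (leaves l) (leaves r) → firstLeaf l ∉ leaves r
    firstLeafˡ∉ʳ l#r l₁∈r = l#r (firstLeaf-∈ l , l₁∈r)

  ∉⇒≢ : ∀ {L} → x ∉ L → y ∈ L → x ≢ y
  ∉⇒≢ x∉ y∈ refl = x∉ y∈

  disjoint⇒≢ : ∀ {L L′} → Disjoint L L′ → x ∈ L → y ∈ L′ → x ≢ y
  disjoint⇒≢ L#L′ x∈ y∈ refl = L#L′ (x∈ , y∈)

  Within : List (Fin n) → Triple {n} → Set
  Within L t = a t ∈ L × b t ∈ L × c t ∈ L

  Within-mono : ∀ {L L′} → L ⊆ L′ → ∀ {t} → Within L t → Within L′ t
  Within-mono L⊆L′ (a∈ , b∈ , c∈) = L⊆L′ a∈ , L⊆L′ b∈ , L⊆L′ c∈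

  _∉ᵗ_ : Fin n → Triple {n} → Set
  x ∉ᵗ t = x ≢ a t × x ≢ b t × x ≢ c t

  ∉⇒∉ᵗ : ∀ {L t} → x ∉ L → Within L t → x ∉ᵗ t
  ∉⇒∉ᵗ x∉ (a∈ , b∈ , c∈) = ∉⇒≢ x∉ a∈ , ∉⇒≢ x∉ b∈ , ∉⇒≢ x∉ c∈

  Private : Triple {n} → Triple {n} → Set
  Private t u = b t ∉ᵗ u

  ∣q∣<∣p∪q∣ : (p q : Subset n) → x Subset.∈ p → x Subset.∉ q → ∣ q ∣ < ∣ p ∪ q ∣
  ∣q∣<∣p∪q∣ p q x∈p x∉q = p⊂q⇒∣p∣<∣q∣ (q⊆p∪q p q , _ , x∈p∪q⁺ (inj₁ x∈p) , x∉q)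

  ∈-leafSet⁻ : ∀ {t} → x Subset.∈ leafSet t → x ≡ a t ⊎ x ≡ b t ⊎ x ≡ c t
  ∈-leafSet⁻ {t = t} x∈ with x∈p∪q⁻ ⁅ a t ⁆ _ x∈
  ... | inj₁ x∈a = inj₁ (x∈⁅y⁆⇒x≡y _ x∈a)
  ... | inj₂ x∈bc = inj₂ (Data.Sum.map (x∈⁅y⁆⇒x≡y _) (x∈⁅y⁆⇒x≡y _) (x∈p∪q⁻ ⁅ b t ⁆ _ x∈bc))

  a∈leafSet : (t : Triple {n}) → a t Subset.∈ leafSet t
  a∈leafSet t = x∈p∪q⁺ (inj₁ (x∈⁅x⁆ (a t)))

  b∈leafSet : (t : Triple {n}) → b t Subset.∈ leafSet t
  b∈leafSet t = x∈p∪q⁺ (inj₂ (x∈p∪q⁺ (inj₁ (x∈⁅x⁆ (b t)))))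

  c∈leafSet : (t : Triple {n}) → c t Subset.∈ leafSet t
  c∈leafSet t = x∈p∪q⁺ (inj₂ (x∈p∪q⁺ (inj₂ (x∈⁅x⁆ (c t)))))

  ∉ᵗ⇒∉leafSet : ∀ {t} → x ∉ᵗ t → x Subset.∉ leafSet t
  ∉ᵗ⇒∉leafSet (x≢a , x≢b , x≢c) = [ x≢a , [ x≢b , x≢c ] ] ∘ ∈-leafSet⁻

  3≤∣leafSet∣ : ∀ {t} → ValidTriple t → 3 ≤ ∣ leafSet t ∣
  3≤∣leafSet∣ {t} (a≢b , a≢c , b≢c) = begin
    3                         ≡⟨ cong (2 +_) (sym (∣⁅x⁆∣≡1 (c t))) ⟩
    suc (suc ∣ ⁅ c t ⁆ ∣)      ≤⟨ s≤s (∣q∣<∣p∪q∣ ⁅ b t ⁆ ⁅ c t ⁆ (x∈⁅x⁆ (b t)) (b≢c ∘ x∈⁅y⁆⇒x≡y _)) ⟩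
    suc ∣ ⁅ b t ⁆ ∪ ⁅ c t ⁆ ∣  ≤⟨ ∣q∣<∣p∪q∣ ⁅ a t ⁆ _ (x∈⁅x⁆ (a t)) a∉bc ⟩
    ∣ leafSet t ∣              ∎
    where
    open ≤-Reasoning
    a∉bc : a t Subset.∉ ⁅ b t ⁆ ∪ ⁅ c t ⁆
    a∉bc = [ a≢b ∘ x∈⁅y⁆⇒x≡y _ , a≢c ∘ x∈⁅y⁆⇒x≡y _ ] ∘ x∈p∪q⁻ ⁅ b t ⁆ _

  -- The set R_T

  rootTriple : Binary S → Fin n → List (Triple {n})
  rootTriple (leaf _) z = []
  rootTriple (node {l} {r} _ _) z = (firstLeaf l ∣∣ firstLeaf r ∣ z) ∷ []

  mutual
    defining : Binary S → List (Triple {n})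
    defining (leaf _) = []
    defining (node {l} {r} bl br) = definingWith bl (firstLeaf r) ++ definingWith br (firstLeaf l)

    -- z is an outgroup of S: the root triple separates the two sides of S from z.
    definingWith : Binary S → Fin n → List (Triple {n})
    definingWith bS z = defining bS ++ rootTriple bS z

  rootTriple-within : (bS : Binary S) → All (Within (z ∷ leaves S)) (rootTriple bS z)
  rootTriple-within (leaf _) = []
  rootTriple-within (node {l} {r} _ _) =
    (there (∈ˡ (firstLeaf-∈ l)) , there (∈ʳ (firstLeaf-∈ r)) , here refl) ∷ []
    where open Cherry l r

  mutual
    defining-within : (bS : Binary S) → All (Within (leaves S)) (defining bS)
    defining-within (node {l} {r} bl br) =
      Allₚ.++⁺ (All.map (Within-mono (∈-∷⁺ʳ (∈ʳ (firstLeaf-∈ r)) ∈ˡ)) (definingWith-within bl))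
              (All.map (Within-mono (∈-∷⁺ʳ (∈ˡ (firstLeaf-∈ l)) ∈ʳ)) (definingWith-within br))
      where open Cherry l r
    defining-within (leaf _) = []

    definingWith-within : (bS : Binary S) → All (Within (z ∷ leaves S)) (definingWith bS z)
    definingWith-within bS =
      Allₚ.++⁺ (All.map (Within-mono there) (defining-within bS)) (rootTriple-within bS)

  Fresh : Tree n → Triple {n} → Set
  Fresh S t = b t ∈ leaves S × b t ≢ firstLeaf S

  mutual
    definingWith-fresh : (bS : Binary S) → Unique (leaves S) → All (Fresh S) (definingWith bS z)
    definingWith-fresh (leaf _) _ = []
    definingWith-fresh (node {l} {r} bl br) uS =
      Allₚ.++⁺ (All.map (λ (b∈ , b≢l , _) → b∈ , b≢l) (defining-node-fresh bl br uS))
              ((∈ʳ (firstLeaf-∈ r) , disjoint⇒≢ (Disjoint.sym l#r) (firstLeaf-∈ r) (firstLeaf-∈ l)) ∷ [])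
      where open Cherry l r
            l#r = proj₂ (proj₂ (Unique⁻ uS))

    defining-node-fresh : (bl : Binary l) (br : Binary r) → Unique (leaves (node (l ∷ r ∷ []))) →
      All (λ t → b t ∈ leaves (node (l ∷ r ∷ [])) × b t ≢ firstLeaf l × b t ≢ firstLeaf r)
          (defining (node bl br))
    defining-node-fresh {l} {r} bl br uS with Cherry.Unique⁻ l r uS
    ... | ul , ur , l#r =
      Allₚ.++⁺ (All.map (λ (b∈l , b≢l) → ∈ˡ b∈l , b≢l , disjoint⇒≢ l#r b∈l (firstLeaf-∈ r))
                       (definingWith-fresh bl ul))
              (All.map (λ (b∈r , b≢r) → ∈ʳ b∈r , disjoint⇒≢ (Disjoint.sym l#r) b∈r (firstLeaf-∈ l) , b≢r)
                       (definingWith-fresh br ur))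
      where open Cherry l r

  rootTriple-valid : (bS : Binary S) → Unique (leaves S) → z ∉ leaves S →
                     All ValidTriple (rootTriple bS z)
  rootTriple-valid (leaf _) _ _ = []
  rootTriple-valid (node {l} {r} _ _) uS z∉ =
    ( disjoint⇒≢ (proj₂ (proj₂ (Unique⁻ uS))) (firstLeaf-∈ l) (firstLeaf-∈ r)
    , (λ e → ∉⇒≢ z∉ (∈ˡ (firstLeaf-∈ l)) (sym e))
    , (λ e → ∉⇒≢ z∉ (∈ʳ (firstLeaf-∈ r)) (sym e))) ∷ []
    where open Cherry l r

  mutual
    defining-valid : (bS : Binary S) → Unique (leaves S) → All ValidTriple (defining bS)
    defining-valid (leaf _) _ = []
    defining-valid (node {l} {r} bl br) uS with Cherry.Unique⁻ l r uS
    ... | ul , ur , l#r =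
      Allₚ.++⁺ (definingWith-valid bl ul (Cherry.firstLeafʳ∉ˡ l r l#r))
              (definingWith-valid br ur (Cherry.firstLeafˡ∉ʳ l r l#r))

    definingWith-valid : (bS : Binary S) → Unique (leaves S) → z ∉ leaves S →
                         All ValidTriple (definingWith bS z)
    definingWith-valid bS uS z∉ = Allₚ.++⁺ (defining-valid bS uS) (rootTriple-valid bS uS z∉)

  mutual
    defining-private : (bS : Binary S) → Unique (leaves S) → AllPairs Private (defining bS)
    defining-private (leaf _) _ = []
    defining-private (node {l} {r} bl br) uS with Cherry.Unique⁻ l r uS
    ... | ul , ur , l#r =
      AllPairsₚ.++⁺ (definingWith-private bl ul (Cherry.firstLeafʳ∉ˡ l r l#r))
                   (definingWith-private br ur (Cherry.firstLeafˡ∉ʳ l r l#r))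
                   (All.map (λ (b∈l , b≢l) → All.map (∉⇒∉ᵗ (b∉ b∈l b≢l)) (definingWith-within br))
                            (definingWith-fresh bl ul))
      where
      b∉ : y ∈ leaves l → y ≢ firstLeaf l → y ∉ firstLeaf l ∷ leaves r
      b∉ y∈l y≢l (here y≡l) = y≢l y≡l
      b∉ y∈l y≢l (there y∈r) = l#r (y∈l , y∈r)

    definingWith-private : (bS : Binary S) → Unique (leaves S) → z ∉ leaves S →
                           AllPairs Private (definingWith bS z)
    definingWith-private (leaf _) _ _ = []
    definingWith-private (node bl br) uS z∉ =
      AllPairsₚ.++⁺ (defining-private (node bl br) uS) ([] ∷ [])
        (All.map (λ (b∈ , b≢l , b≢r) → (b≢l , b≢r , ∉⇒≢ z∉ b∈ ∘ sym) ∷ []) (defining-node-fresh bl br uS))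

  rootTriple-displayed : (bS : Binary S) → S ⊑ T → z ∉ leaves S → DisplaysAll T (rootTriple bS z)
  rootTriple-displayed (leaf _) _ _ = []
  rootTriple-displayed (node {l} {r} _ _) S⊑T z∉ =
    (_ , S⊑T , ∈ˡ (firstLeaf-∈ l) , ∈ʳ (firstLeaf-∈ r) , z∉) ∷ []
    where open Cherry l r

  mutual
    defining-displayed : (bS : Binary S) → S ⊑ T → Unique (leaves S) → DisplaysAll T (defining bS)
    defining-displayed (leaf _) _ _ = []
    defining-displayed (node {l} {r} bl br) S⊑T uS with Cherry.Unique⁻ l r uS
    ... | ul , ur , l#r =
      Allₚ.++⁺ (definingWith-displayed bl (⊑-trans (child here (VecAny.here refl)) S⊑T) ul
                                      (Cherry.firstLeafʳ∉ˡ l r l#r))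
              (definingWith-displayed br (⊑-trans (child here (VecAny.there (VecAny.here refl))) S⊑T) ur
                                      (Cherry.firstLeafˡ∉ʳ l r l#r))

    definingWith-displayed : (bS : Binary S) → S ⊑ T → Unique (leaves S) → z ∉ leaves S →
                             DisplaysAll T (definingWith bS z)
    definingWith-displayed bS S⊑T uS z∉ =
      Allₚ.++⁺ (defining-displayed bS S⊑T uS) (rootTriple-displayed bS S⊑T z∉)

  mutual
    length-definingWith : (bS : Binary S) → suc (length (definingWith bS z)) ≡ length (leaves S)
    length-definingWith (leaf _) = refl
    length-definingWith {z = z} bS@(node {l} {r} bl br) = begin
      suc (length (defining bS ++ rootTriple bS z)) ≡⟨ cong suc (length-++ (defining bS)) ⟩
      suc (length (defining bS) + 1)               ≡⟨ sym (+-suc _ 1) ⟩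
      length (defining bS) + 2                     ≡⟨ length-defining-node bl br ⟩
      length (leaves (node (l ∷ r ∷ [])))         ∎
      where open ≡-Reasoning

    length-defining-node : (bl : Binary l) (br : Binary r) →
                       length (defining (node bl br)) + 2 ≡ length (leaves (node (l ∷ r ∷ [])))
    length-defining-node {l} {r} bl br = begin
      length (L ++ R) + 2              ≡⟨ cong (_+ 2) (length-++ L) ⟩
      length L + length R + 2          ≡⟨ +-comm (length L + length R) 2 ⟩
      suc (suc (length L + length R))  ≡⟨ cong suc (sym (+-suc (length L) (length R))) ⟩
      suc (length L) + suc (length R)  ≡⟨ cong₂ _+_ (length-definingWith bl) (length-definingWith br) ⟩
      length (leaves l) + length (leaves r) ≡⟨ sym (length-++ (leaves l)) ⟩
      length (leaves l ++ leaves r)   ≡⟨ cong length (sym (Cherry.leaves-cherry l r)) ⟩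
      length (leaves (node (l ∷ r ∷ []))) ∎
      where
      open ≡-Reasoning
      L = definingWith bl (firstLeaf r)
      R = definingWith br (firstLeaf l)

  length-defining : (bS : Binary S) → length (defining bS) ≡ length (leaves S) ∸ 2
  length-defining (leaf _) = refl
  length-defining (node bl br) =
    trans (sym (m+n∸n≡m _ 2)) (cong (_∸ 2) (length-defining-node bl br))

  displays-restrict : v ⊑ T → Unique (leaves T) → ∀ {R} →
                      All (Within (leaves v)) R → DisplaysAll T R → DisplaysAll v R
  displays-restrict v⊑T uT [] [] = []
  displays-restrict v⊑T uT ((a∈v , _ , c∈v) ∷ ws) ((w , w⊑T , a∈w , b∈w , c∉w) ∷ ds) =
    (w , overlap⇒⊑ uT w⊑T v⊑T a∈w a∈v c∈v c∉w , a∈w , b∈w , c∉w) ∷ displays-restrict v⊑T uT ws ds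

  displays-at : v ⊑ T → ∀ {t} → ValidTriple t →
                (∀ {y} → y Subset.∈ leafSet t → y ≢ c t → y ∈ leaves v) → c t ∉ leaves v → Displays T t
  displays-at v⊑T {t} (_ , a≢c , b≢c) a,b∈v c∉v =
    _ , v⊑T , a,b∈v (a∈leafSet t) a≢c , a,b∈v (b∈leafSet t) b≢c , c∉v

  cluster : (bS : Binary S) → Unique (leaves S) → z ∉ leaves S → Unique (leaves T) →
            leaves S ⊆ leaves T → DisplaysAll T (definingWith bS z) →
            ∃[ v ] v ⊑ T × leaves S ⊆ leaves v × z ∉ leaves v
  cluster (leaf x) _ z∉ _ S⊆T _ = leaf x , leaf-⊑ (S⊆T (here refl)) , (λ x∈ → x∈) , z∉
  cluster (node {l} {r} bl br) uS z∉ uT S⊆T d with Allₚ.++⁻ʳ (defining (node bl br)) d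
  ... | (w , w⊑T , l₁∈w , r₁∈w , z∉w) ∷ [] = w , w⊑T , S⊆w , z∉w
    where
    open Cherry l r
    S⊆w : leaves (node (l ∷ r ∷ [])) ⊆ leaves w
    S⊆w with Unique⁻ uS | Allₚ.++⁻ (definingWith bl (firstLeaf r)) (Allₚ.++⁻ˡ (defining (node bl br)) d)
    ... | ul , ur , l#r | dl , dr
      with cluster bl ul (Cherry.firstLeafʳ∉ˡ l r l#r) uT (S⊆T ∘ ∈ˡ) dl
         | cluster br ur (Cherry.firstLeafˡ∉ʳ l r l#r) uT (S⊆T ∘ ∈ʳ) dr
    ... | v₁ , v₁⊑T , l⊆v₁ , r₁∉v₁ | v₂ , v₂⊑T , r⊆v₂ , l₁∉v₂ = [ l⊆w , r⊆w ] ∘ ∈⁻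
      where
      l⊆w = ⊑-leaves (overlap⇒⊑ uT v₁⊑T w⊑T (l⊆v₁ (firstLeaf-∈ l)) l₁∈w r₁∈w r₁∉v₁) ∘ l⊆v₁
      r⊆w = ⊑-leaves (overlap⇒⊑ uT v₂⊑T w⊑T (r⊆v₂ (firstLeaf-∈ r)) r₁∈w l₁∈w l₁∉v₂) ∘ r⊆v₂

  children-match-cherry : Unique (leaves (node ts)) → leaves (node ts) ⊆ leaves (node (l ∷ r ∷ [])) →
    ∀ {i₁ i₂} → leaves l ⊆ leaves (lookup ts i₁) → leaves r ⊆ leaves (lookup ts i₂) →
    (∀ q → q ≡ i₁ ⊎ q ≡ i₂) ×
    (i₁ ≢ i₂ → leaves (lookup ts i₁) ⊆ leaves l × leaves (lookup ts i₂) ⊆ leaves r)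
  children-match-cherry {ts = ts} {l = l} {r = r} uT T⊆S {i₁} {i₂} l⊆tᵢ₁ r⊆tᵢ₂ = cover , exact
    where
    sameChild : ∀ {i j} → x ∈ leaves (lookup ts i) → x ∈ leaves (lookup ts j) → i ≡ j
    sameChild = shared-leaf⇒same-index ts uT

    ∈S : ∀ {i} → x ∈ leaves (lookup ts i) → x ∈ leaves l ⊎ x ∈ leaves r
    ∈S {i = i} = Cherry.∈⁻ l r ∘ T⊆S ∘ ∈-leavesV (∈-lookupᵛ i ts)

    cover : ∀ q → q ≡ i₁ ⊎ q ≡ i₂
    cover q with ∈S (firstLeaf-∈ (lookup ts q))
    ... | inj₁ x∈l = inj₁ (sameChild (firstLeaf-∈ (lookup ts q)) (l⊆tᵢ₁ x∈l))
    ... | inj₂ x∈r = inj₂ (sameChild (firstLeaf-∈ (lookup ts q)) (r⊆tᵢ₂ x∈r))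

    exact : i₁ ≢ i₂ → leaves (lookup ts i₁) ⊆ leaves l × leaves (lookup ts i₂) ⊆ leaves r
    exact i₁≢i₂ =
      (λ x∈ → [ (λ x∈l → x∈l) , (λ x∈r → ⊥-elim (i₁≢i₂ (sameChild x∈ (r⊆tᵢ₂ x∈r)))) ] (∈S x∈)) ,
      (λ x∈ → [ (λ x∈l → ⊥-elim (i₁≢i₂ (sameChild (l⊆tᵢ₁ x∈l) x∈))) , (λ x∈r → x∈r) ] (∈S x∈))

  node-≅-cherry : {ts : Vec (Tree n) (suc (suc k))} (i₁ i₂ : Fin (suc (suc k))) →
                  (∀ q → q ≡ i₁ ⊎ q ≡ i₂) → (i₁ ≢ i₂ → lookup ts i₁ ≅ l × lookup ts i₂ ≅ r) →
                  node ts ≅ node (l ∷ r ∷ [])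
  node-≅-cherry {k = suc _} i₁ i₂ cover _
    with cover zero | cover (suc zero) | cover (suc (suc zero))
  ... | inj₁ refl | inj₁ ()   | _
  ... | inj₁ refl | inj₂ refl | inj₁ ()
  ... | inj₁ refl | inj₂ refl | inj₂ ()
  ... | inj₂ refl | inj₁ refl | inj₁ ()
  ... | inj₂ refl | inj₁ refl | inj₂ ()
  ... | inj₂ refl | inj₂ ()   | _
  node-≅-cherry {k = zero} zero zero cover _ with cover (suc zero)
  ... | inj₁ ()
  ... | inj₂ ()
  node-≅-cherry {k = zero} (suc zero) (suc zero) cover _ with cover zero
  ... | inj₁ ()
  ... | inj₂ ()
  node-≅-cherry {k = zero} {ts = _ ∷ _ ∷ []} zero (suc zero) _ children
    with t₀≅l , t₁≅r ← children (λ ()) = node id λ { zero → t₀≅l ; (suc zero) → t₁≅r }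
  node-≅-cherry {k = zero} {ts = _ ∷ _ ∷ []} (suc zero) zero _ children
    with t₁≅l , t₀≅r ← children (λ ()) =
    node (transpose zero (suc zero)) λ { zero → t₀≅r ; (suc zero) → t₁≅l }

  leaves⊆[x]⇒leaf : Unique (leaves T) → leaves T ⊆ x ∷ [] → T ≡ leaf x
  leaves⊆[x]⇒leaf {T = leaf _} _ T⊆[x] with T⊆[x] (here refl)
  ... | here refl = refl
  leaves⊆[x]⇒leaf {T = node ts@(t₀ ∷ t₁ ∷ _)} uT T⊆[x]
    with T⊆[x] (∈-leavesV (∈-lookupᵛ zero ts) (firstLeaf-∈ t₀))
       | T⊆[x] (∈-leavesV (∈-lookupᵛ (suc zero) ts) (firstLeaf-∈ t₁))
  ... | here e₀ | here e₁
    with () ← shared-leaf⇒same-index ts uT {zero} {suc zero}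
                (subst (_∈ leaves t₀) e₀ (firstLeaf-∈ t₀)) (subst (_∈ leaves t₁) e₁ (firstLeaf-∈ t₁))

  -- The clusters of the two sides of S lie in children i₁, i₂ of the root of T, and these are
  -- then its only children.
  defining-unique : (bS : Binary S) → Unique (leaves S) → Unique (leaves T) →
                    leaves S ⊆ leaves T → leaves T ⊆ leaves S → DisplaysAll T (defining bS) → T ≅ S
  defining-unique {T = T} (leaf x) _ uT _ T⊆S _ with refl ← leaves⊆[x]⇒leaf {T = T} uT T⊆S = leaf x
  defining-unique {S = S} {T = leaf _} (node _ _) uS _ S⊆T _ _ with () ← leaves⊆[x]⇒leaf {T = S} uS S⊆T
  defining-unique {T = node ts} (node {l} {r} bl br) uS uT S⊆T T⊆S d
    with Cherry.Unique⁻ l r uS | Allₚ.++⁻ (definingWith bl (firstLeaf r)) d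
  ... | ul , ur , l#r | dl , dr
    with cluster bl ul (Cherry.firstLeafʳ∉ˡ l r l#r) uT (S⊆T ∘ Cherry.∈ˡ l r) dl
       | cluster br ur (Cherry.firstLeafˡ∉ʳ l r l#r) uT (S⊆T ∘ Cherry.∈ʳ l r) dr
  ... | v₁ , v₁⊑T , l⊆v₁ , r₁∉v₁ | v₂ , v₂⊑T , r⊆v₂ , l₁∉v₂
    with ⊑-inside-child v₁⊑T (S⊆T (Cherry.∈ʳ l r (firstLeaf-∈ r))) r₁∉v₁
       | ⊑-inside-child v₂⊑T (S⊆T (Cherry.∈ˡ l r (firstLeaf-∈ l))) l₁∉v₂
  ... | i₁ , v₁⊆tᵢ₁ | i₂ , v₂⊆tᵢ₂
    with cover , exact ← children-match-cherry {ts = ts} {l = l} {r = r} uT T⊆S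
                                                (v₁⊆tᵢ₁ ∘ l⊆v₁) (v₂⊆tᵢ₂ ∘ r⊆v₂)
    = node-≅-cherry i₁ i₂ cover λ i₁≢i₂ →
        child-≅ bl ul i₁ (v₁⊆tᵢ₁ ∘ l⊆v₁) (proj₁ (exact i₁≢i₂)) (Allₚ.++⁻ˡ (defining bl) dl) ,
        child-≅ br ur i₂ (v₂⊆tᵢ₂ ∘ r⊆v₂) (proj₂ (exact i₁≢i₂)) (Allₚ.++⁻ˡ (defining br) dr)
    where
    child-≅ : (bX : Binary S) → Unique (leaves S) → ∀ i → leaves S ⊆ leaves (lookup ts i) →
              leaves (lookup ts i) ⊆ leaves S → DisplaysAll (node ts) (defining bX) → lookup ts i ≅ S
    child-≅ bX uX i X⊆tᵢ tᵢ⊆X dX =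
      defining-unique bX uX (Unique-leavesV (∈-lookupᵛ i ts) uT) X⊆tᵢ tᵢ⊆X
        (displays-restrict (child here (∈-lookupᵛ i ts)) uT
                           (All.map (Within-mono X⊆tᵢ) (defining-within bX)) dX)

  -- Thin collections

  data Peelable : List (Subset n) → Set where
    [] : Peelable []
    _∷_ : ∀ {s τ} → (∃[ x ] x Subset.∈ s × All (x Subset.∉_) τ) → Peelable τ → Peelable (s ∷ τ)

  ∉-Lsel : (τ : List (Subset n)) → All (x Subset.∉_) τ → (σ : Subset (length τ)) → x Subset.∉ Lsel τ σ
  ∉-Lsel [] [] [] = ∉⊥
  ∉-Lsel (s ∷ τ) (x∉s ∷ x∉τ) (inside ∷ σ) = [ x∉s , ∉-Lsel τ x∉τ σ ] ∘ x∈p∪q⁻ s _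
  ∉-Lsel (s ∷ τ) (_ ∷ x∉τ) (outside ∷ σ) = [ ∉⊥ , ∉-Lsel τ x∉τ σ ] ∘ x∈p∪q⁻ Subset.⊥ _

  peelable⇒thin : (τ : List (Subset n)) → Peelable τ → All (λ s → 3 ≤ ∣ s ∣) τ →
                  (σ : Subset (length τ)) → Nonempty σ → ∣ σ ∣ + 2 ≤ ∣ Lsel τ σ ∣
  peelable⇒thin [] [] [] [] (() , _)
  peelable⇒thin (s ∷ τ) (_ ∷ pτ) (_ ∷ big) (outside ∷ σ) (suc i , VecBase.there i∈σ) =
    subst (λ L → ∣ σ ∣ + 2 ≤ ∣ L ∣) (sym (∪-identityˡ (Lsel τ σ))) (peelable⇒thin τ pτ big σ (i , i∈σ))
  peelable⇒thin (s ∷ τ) ((x , x∈s , x∉τ) ∷ pτ) (3≤s ∷ big) (inside ∷ σ) _ with nonempty? σ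
  ... | yes σ≠∅ =
    ≤-trans (s≤s (peelable⇒thin τ pτ big σ σ≠∅)) (∣q∣<∣p∪q∣ s (Lsel τ σ) x∈s (∉-Lsel τ x∉τ σ))
  ... | no σ=∅ = subst (λ k → suc k + 2 ≤ ∣ s ∪ Lsel τ σ ∣) (sym ∣σ∣≡0) (≤-trans 3≤s (∣p∣≤∣p∪q∣ s _))
    where ∣σ∣≡0 = trans (cong ∣_∣ (Empty-unique σ=∅)) (∣⊥∣≡0 (length τ))

  private⇒¬same : ∀ {t u} → Private t u → ¬ SameTriple t u
  private⇒¬same (_ , b≢b , _) (_ , inj₁ (_ , b≡b)) = b≢b b≡b
  private⇒¬same (b≢a , _ , _) (_ , inj₂ (_ , b≡a)) = b≢a b≡a

  private⇒peelable : ∀ {R} → AllPairs Private R → Peelable (map leafSet R)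
  private⇒peelable [] = []
  private⇒peelable {t ∷ _} (p ∷ ps) =
    (b t , b∈leafSet t , Allₚ.map⁺ (All.map ∉ᵗ⇒∉leafSet p)) ∷ private⇒peelable ps

  private⇒thin : (R : List (Triple {n})) → 0 < length R → All ValidTriple R → AllPairs Private R →
                 ThinLeafSets R
  private⇒thin R 0<∣R∣ valid priv =
    map leafSet R ,
    AllPairsₚ.map⁺ (AllPairs.map (λ {t} p e → ∉ᵗ⇒∉leafSet p (subst (b t Subset.∈_) e (b∈leafSet t)))
                                 priv) ,
    (λ s → mk⇔ to from) ,
    subst (0 <_) (sym (length-map leafSet R)) 0<∣R∣ ,
    peelable⇒thin (map leafSet R) (private⇒peelable priv) (Allₚ.map⁺ (All.map 3≤∣leafSet∣ valid))
    where
    to : ∀ {s} → s ∈ map leafSet R → ∃[ t ] t ∈ R × leafSet t ≡ s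
    to s∈ with t , t∈R , refl ← ∈-map⁻ leafSet s∈ = t , t∈R , refl
    from : ∀ {s} → ∃[ t ] t ∈ R × leafSet t ≡ s → s ∈ map leafSet R
    from (_ , t∈R , refl) = ∈-map⁺ leafSet t∈R

part-i : Part-i
part-i n 3≤n T (uT , complete) bT =
  defining bT , (defining-valid bT uT , AllPairs.map private⇒¬same (defining-private bT uT)) ,
  length-R , defining-displayed bT here uT ,
  (λ T′ (uT′ , complete′) → defining-unique bT uT uT′ (λ _ → complete′ _) (λ _ → complete _)) ,
  private⇒thin (defining bT) (subst (0 <_) (sym length-R) (m<n⇒0<n∸m 3≤n))
               (defining-valid bT uT) (defining-private bT uT)
  where
  length-R : length (defining bT) ≡ n ∸ 2
  length-R = trans (length-defining bT) (cong (_∸ 2) (Unique∧complete⇒length≡ uT complete))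

-- Caterpillars

data Shape : Set where
  resolved unresolved : Shape

module _ {n : ℕ} where

  private variable
    t v T U : Tree n

  caterpillar : Tree n → List (Fin n) → Tree n
  caterpillar t [] = t
  caterpillar t (x ∷ xs) = caterpillar (node (t ∷ leaf x ∷ [])) xs

  hang : Shape → Tree n → List (Fin n) → Tree n
  hang unresolved t (x ∷ y ∷ xs) = caterpillar (node (t ∷ leaf x ∷ leaf y ∷ [])) xs
  hang _ t xs = caterpillar t xs

  ⊑-caterpillar : ∀ xs → v ⊑ t → v ⊑ caterpillar t xs
  ⊑-caterpillar [] v⊑t = v⊑t
  ⊑-caterpillar (x ∷ xs) v⊑t = ⊑-caterpillar xs (child v⊑t (VecAny.here refl))

  ⊑-hang : ∀ sh xs → t ⊑ hang sh t xs
  ⊑-hang resolved xs = ⊑-caterpillar xs here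
  ⊑-hang unresolved [] = here
  ⊑-hang unresolved (x ∷ []) = ⊑-caterpillar (x ∷ []) here
  ⊑-hang unresolved (x ∷ y ∷ xs) = ⊑-caterpillar xs (child here (VecAny.here refl))

  leaves-caterpillar : ∀ t xs → leaves (caterpillar t xs) ≡ leaves t ++ xs
  leaves-caterpillar t [] = sym (++-identityʳ (leaves t))
  leaves-caterpillar t (x ∷ xs) = trans (leaves-caterpillar _ xs) (++-assoc (leaves t) (x ∷ []) xs)

  leaves-hang : ∀ sh t xs → leaves (hang sh t xs) ≡ leaves t ++ xs
  leaves-hang resolved t xs = leaves-caterpillar t xs
  leaves-hang unresolved t [] = leaves-caterpillar t []
  leaves-hang unresolved t (x ∷ []) = leaves-caterpillar t (x ∷ [])
  leaves-hang unresolved t (x ∷ y ∷ xs) =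
    trans (leaves-caterpillar _ xs) (++-assoc (leaves t) (x ∷ y ∷ []) xs)

  Binary-caterpillar : ∀ xs → Binary t → Binary (caterpillar t xs)
  Binary-caterpillar [] bt = bt
  Binary-caterpillar (x ∷ xs) bt = Binary-caterpillar xs (node bt (leaf x))

  Binary-caterpillar⁻ : ∀ xs → Binary (caterpillar t xs) → Binary t
  Binary-caterpillar⁻ [] bt = bt
  Binary-caterpillar⁻ (x ∷ xs) b with Binary-caterpillar⁻ xs b
  ... | node bt _ = bt

  ¬Binary-unresolved : ∀ t xs → 2 ≤ length xs → ¬ Binary (hang unresolved t xs)
  ¬Binary-unresolved t (_ ∷ _ ∷ xs) _ b with Binary-caterpillar⁻ xs b
  ... | ()
  ¬Binary-unresolved t (_ ∷ []) (s≤s ())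

  ≅-Binary : T ≅ U → Binary T → Binary U
  ≅-Binary (leaf x) b = leaf x
  ≅-Binary {U = node (u₀ ∷ u₁ ∷ [])} (node π children≅) b@(node _ _) =
    node (binary zero) (binary (suc zero))
    where
    childBinary : ∀ {l r} → Binary (node (l ∷ r ∷ [])) → ∀ i → Binary (lookup (l ∷ r ∷ []) i)
    childBinary (node bl _) zero = bl
    childBinary (node _ br) (suc zero) = br

    binary : ∀ j → Binary (lookup (u₀ ∷ u₁ ∷ []) j)
    binary j = subst (Binary ∘ lookup (u₀ ∷ u₁ ∷ [])) (inverseʳ π)
                 (≅-Binary (children≅ (π ⟨$⟩ˡ j)) (childBinary b (π ⟨$⟩ˡ j)))

-- The collection τ of part (ii)

data Side : Set where
  near₀ near₁ apart : Side

toFin : Side → Fin 3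
toFin near₀ = zero
toFin near₁ = suc zero
toFin apart = suc (suc zero)

toFin-injective : ∀ {s s′} → toFin s ≡ toFin s′ → s ≡ s′
toFin-injective {near₀} {near₀} _ = refl
toFin-injective {near₁} {near₁} _ = refl
toFin-injective {apart} {apart} _ = refl
toFin-injective {near₀} {near₁} ()
toFin-injective {near₀} {apart} ()
toFin-injective {near₁} {near₀} ()
toFin-injective {near₁} {apart} ()
toFin-injective {apart} {near₀} ()
toFin-injective {apart} {near₁} ()

_≟ˢ_ : DecidableEquality Side
s ≟ˢ s′ = map′ toFin-injective (cong toFin) (toFin s ≟ᶠ toFin s′)

resolvedEverywhere : Side → Shape
resolvedEverywhere _ = resolved

unresolvedAt : Side → Side → Shape
unresolvedAt g s = if does (s ≟ˢ g) then unresolved else resolved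

module PairStar (m : ℕ) where

  N : ℕ
  N = suc (suc m)

  x₀ x₁ : Fin N
  x₀ = zero
  x₁ = suc zero

  label : Fin m → Fin N
  label j = suc (suc j)

  pairSet : Fin m → Subset N
  pairSet j = leafSet (x₀ ∣∣ x₁ ∣ label j)

  τ : List (Subset N)
  τ = tabulate pairSet

  ∣pairSet∣≡3 : ∀ j → ∣ pairSet j ∣ ≡ 3
  ∣pairSet∣≡3 j = cong (2 +_)
    (trans (cong ∣_∣ (trans (∪-identityˡ _) (∪-identityˡ ⁅ j ⁆))) (∣⁅x⁆∣≡1 j))

  pairSet-injective : ∀ {i j} → pairSet i ≡ pairSet j → i ≡ j
  pairSet-injective {i} {j} eq
    with ∈-leafSet⁻ {t = x₀ ∣∣ x₁ ∣ label j}
           (subst (label i Subset.∈_) eq (c∈leafSet (x₀ ∣∣ x₁ ∣ label i)))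
  ... | inj₂ (inj₂ refl) = refl

  -- The leaf separated by the chosen triple on {x₀, x₁, x} tells on which side of {x₀, x₁} x sits.
  sideOf : Fin N → Side
  sideOf zero = near₁
  sideOf (suc zero) = near₀
  sideOf (suc (suc _)) = apart

  module _ (f : Choice τ) where

    position : Fin m → Fin (length τ)
    position = cast (sym (length-tabulate pairSet))

    picked : Fin m → Triple {N}
    picked j = proj₁ (f (position j))

    picked-valid : ∀ j → ValidTriple (picked j)
    picked-valid j = proj₁ (proj₂ (f (position j)))

    ∈-picked⁻ : ∀ {j y} → y Subset.∈ leafSet (picked j) → y ≡ x₀ ⊎ y ≡ x₁ ⊎ y ≡ label j
    ∈-picked⁻ {j} = ∈-leafSet⁻ ∘ subst (_ Subset.∈_)
      (trans (proj₂ (proj₂ (f (position j)))) (lookup-tabulate pairSet j))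

    side : Fin m → Side
    side j = sideOf (c (picked j))

    place : Fin N → Side
    place zero = near₀
    place (suc zero) = near₁
    place (suc (suc j)) = side j

    members : Side → List (Fin N)
    members s = filter (λ x → place x ≟ˢ s) (tabulate label)

    block : Side → List (Fin N)
    block near₀ = x₀ ∷ members near₀
    block near₁ = x₁ ∷ members near₁
    block apart = members apart

    label-injective : ∀ {i j} → label i ≡ label j → i ≡ j
    label-injective refl = refl

    members-place : ∀ s → All (λ x → place x ≡ s) (members s)
    members-place s = Allₚ.all-filter (λ x → place x ≟ˢ s) (tabulate label)

    members-unique : ∀ s → Unique (members s)
    members-unique s = Uniqueₚ.filter⁺ (λ x → place x ≟ˢ s) (Uniqueₚ.tabulate⁺ label-injective)

    members-≢ : ∀ {s x} → (∀ j → x ≢ label j) → All (x ≢_) (members s)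
    members-≢ x≢label = Allₚ.filter⁺ _ (Allₚ.tabulate⁺ x≢label)

    block-place : ∀ s → All (λ x → place x ≡ s) (block s)
    block-place near₀ = refl ∷ members-place near₀
    block-place near₁ = refl ∷ members-place near₁
    block-place apart = members-place apart

    block-unique : ∀ s → Unique (block s)
    block-unique near₀ = members-≢ (λ _ ()) ∷ members-unique near₀
    block-unique near₁ = members-≢ (λ _ ()) ∷ members-unique near₁
    block-unique apart = members-unique apart

    members⊆block : ∀ s → members s ⊆ block s
    members⊆block near₀ = there
    members⊆block near₁ = there
    members⊆block apart = λ x∈ → x∈

    ∈-block⁺ : ∀ {x s} → place x ≡ s → x ∈ block s
    ∈-block⁺ {zero} refl = here refl
    ∈-block⁺ {suc zero} refl = here refl
    ∈-block⁺ {suc (suc j)} {s} e = members⊆block s (∈-filter⁺ (λ x → place x ≟ˢ s) (∈-tabulate⁺ j) e)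

    ∈-block⁻ : ∀ {x s} → x ∈ block s → place x ≡ s
    ∈-block⁻ {s = s} = All.lookup (block-place s)

    placed-elsewhere : ∀ {s s′ xs} → s ≢ s′ → All (λ x → place x ≡ s) xs → All (λ x → place x ≢ s′) xs
    placed-elsewhere s≢s′ = All.map (λ e e′ → s≢s′ (trans (sym e) e′))

    module Build (shape : Side → Shape) where

      V₀ V₁ W tree : Tree N
      V₀ = hang (shape near₀) (leaf x₀) (members near₀)
      V₁ = hang (shape near₁) (leaf x₁) (members near₁)
      W = node (V₀ ∷ V₁ ∷ [])
      tree = hang (shape apart) W (members apart)

      leaves-V₀ : leaves V₀ ≡ block near₀
      leaves-V₀ = leaves-hang (shape near₀) (leaf x₀) (members near₀)

      leaves-V₁ : leaves V₁ ≡ block near₁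
      leaves-V₁ = leaves-hang (shape near₁) (leaf x₁) (members near₁)

      leaves-W : leaves W ≡ block near₀ ++ block near₁
      leaves-W = trans (Cherry.leaves-cherry V₀ V₁) (cong₂ _++_ leaves-V₀ leaves-V₁)

      leaves-tree : leaves tree ≡ (block near₀ ++ block near₁) ++ block apart
      leaves-tree =
        trans (leaves-hang (shape apart) W (members apart)) (cong (_++ members apart) leaves-W)

      W⊑tree : W ⊑ tree
      W⊑tree = ⊑-hang (shape apart) (members apart)

      V₀⊑tree : V₀ ⊑ tree
      V₀⊑tree = ⊑-trans (child here (VecAny.here refl)) W⊑tree

      V₁⊑tree : V₁ ⊑ tree
      V₁⊑tree = ⊑-trans (child here (VecAny.there (VecAny.here refl))) W⊑tree

      tree-phylo : PhyloTree tree
      tree-phylo = subst Unique (sym leaves-tree) unique , complete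
        where
        unique : Unique ((block near₀ ++ block near₁) ++ block apart)
        unique = Uniqueₚ.++⁺
          (Uniqueₚ.++⁺ (block-unique near₀) (block-unique near₁)
            (All∧All¬⇒Disjoint (block-place near₀) (placed-elsewhere (λ ()) (block-place near₁))))
          (block-unique apart)
          (All∧All¬⇒Disjoint
            (Allₚ.++⁺ (placed-elsewhere (λ ()) (block-place near₀))
                      (placed-elsewhere (λ ()) (block-place near₁)))
            (All.map (λ e e≢ → e≢ e) (block-place apart)))

        block⊆ : ∀ s → block s ⊆ (block near₀ ++ block near₁) ++ block apart
        block⊆ near₀ = ∈-++⁺ˡ ∘ ∈-++⁺ˡ
        block⊆ near₁ = ∈-++⁺ˡ ∘ ∈-++⁺ʳ (block near₀)
        block⊆ apart = ∈-++⁺ʳ (block near₀ ++ block near₁)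

        complete : ∀ x → x ∈ leaves tree
        complete x = subst (x ∈_) (sym leaves-tree) (block⊆ (place x) (∈-block⁺ refl))

      displayed-at-block : ∀ {v s} j → v ⊑ tree → leaves v ≡ block s →
        (∀ {y} → y ≡ x₀ ⊎ y ≡ x₁ ⊎ y ≡ label j → y ≢ c (picked j) → place y ≡ s) →
        place (c (picked j)) ≢ s → Displays tree (picked j)
      displayed-at-block j v⊑tree leaves≡block placed misplaced =
        displays-at v⊑tree (picked-valid j)
          (λ y∈ y≢c → subst (_ ∈_) (sym leaves≡block) (∈-block⁺ (placed (∈-picked⁻ y∈) y≢c)))
          (misplaced ∘ ∈-block⁻ ∘ subst (_ ∈_) leaves≡block)

      picked-displayed : ∀ j → Displays tree (picked j)
      picked-displayed j with ∈-picked⁻ (c∈leafSet (picked j))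
      ... | inj₁ c≡x₀ = displayed-at-block j V₁⊑tree leaves-V₁ placed misplaced
        where
        placed : ∀ {y} → y ≡ x₀ ⊎ y ≡ x₁ ⊎ y ≡ label j → y ≢ c (picked j) → place y ≡ near₁
        placed (inj₁ y≡x₀) y≢c = ⊥-elim (y≢c (trans y≡x₀ (sym c≡x₀)))
        placed (inj₂ (inj₁ refl)) _ = refl
        placed (inj₂ (inj₂ refl)) _ = cong sideOf c≡x₀
        misplaced : place (c (picked j)) ≢ near₁
        misplaced e with () ← trans (sym (cong place c≡x₀)) e
      ... | inj₂ (inj₁ c≡x₁) = displayed-at-block j V₀⊑tree leaves-V₀ placed misplaced
        where
        placed : ∀ {y} → y ≡ x₀ ⊎ y ≡ x₁ ⊎ y ≡ label j → y ≢ c (picked j) → place y ≡ near₀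
        placed (inj₁ refl) _ = refl
        placed (inj₂ (inj₁ y≡x₁)) y≢c = ⊥-elim (y≢c (trans y≡x₁ (sym c≡x₁)))
        placed (inj₂ (inj₂ refl)) _ = cong sideOf c≡x₁
        misplaced : place (c (picked j)) ≢ near₀
        misplaced e with () ← trans (sym (cong place c≡x₁)) e
      ... | inj₂ (inj₂ c≡label) =
        displays-at W⊑tree (picked-valid j)
          (λ y∈ y≢c → subst (_ ∈_) (sym leaves-W) (in-W (∈-picked⁻ y∈) y≢c))
          (λ c∈ → c∉W (∈-++⁻ (block near₀) (subst (_ ∈_) leaves-W c∈)))
        where
        in-W : ∀ {y} → y ≡ x₀ ⊎ y ≡ x₁ ⊎ y ≡ label j → y ≢ c (picked j) → y ∈ block near₀ ++ block near₁
        in-W (inj₁ refl) _ = ∈-++⁺ˡ {ys = block near₁} (here refl)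
        in-W (inj₂ (inj₁ refl)) _ = ∈-++⁺ʳ (block near₀) (here refl)
        in-W (inj₂ (inj₂ y≡label)) y≢c = ⊥-elim (y≢c (trans y≡label (sym c≡label)))
        place-c : place (c (picked j)) ≡ apart
        place-c = trans (cong place c≡label) (cong sideOf c≡label)
        c∉W : ¬ (c (picked j) ∈ block near₀ ⊎ c (picked j) ∈ block near₁)
        c∉W (inj₁ c∈) with () ← trans (sym (∈-block⁻ {s = near₀} c∈)) place-c
        c∉W (inj₂ c∈) with () ← trans (sym (∈-block⁻ {s = near₁} c∈)) place-c

      tree-displays : DisplaysAll tree (chosen τ f)
      tree-displays = Allₚ.tabulate⁺ λ i →
        subst (λ i → Displays tree (proj₁ (f i)))
              (cast-involutive (sym (length-tabulate pairSet)) (length-tabulate pairSet) i)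
              (picked-displayed (cast (length-tabulate pairSet) i))

    resolved-binary : Binary (Build.tree resolvedEverywhere)
    resolved-binary = Binary-caterpillar (members apart)
      (node (Binary-caterpillar (members near₀) (leaf x₀)) (Binary-caterpillar (members near₁) (leaf x₁)))

    unresolvedAt-¬binary : ∀ g → 2 ≤ length (members g) → ¬ Binary (Build.tree (unresolvedAt g))
    unresolvedAt-¬binary near₀ 2≤ b
      with Binary-caterpillar⁻ {t = Build.W (unresolvedAt near₀)} (members apart) b
    ... | node b₀ _ = ¬Binary-unresolved (leaf x₀) (members near₀) 2≤ b₀
    unresolvedAt-¬binary near₁ 2≤ b
      with Binary-caterpillar⁻ {t = Build.W (unresolvedAt near₁)} (members apart) b
    ... | node _ b₁ = ¬Binary-unresolved (leaf x₁) (members near₁) 2≤ b₁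
    unresolvedAt-¬binary apart 2≤ =
      ¬Binary-unresolved (Build.W (unresolvedAt apart)) (members apart) 2≤

    crowded-side : 4 ≤ m → ∃[ g ] 2 ≤ length (members g)
    crowded-side 4≤m with i , j , i<j , same ← pigeonhole 4≤m (toFin ∘ side) =
      side j , two-members⇒2≤length (∈-filter⁺ _ (∈-tabulate⁺ i) (toFin-injective same))
                                    (∈-filter⁺ _ (∈-tabulate⁺ j) refl)
                                    (<⇒≢ i<j ∘ label-injective)

    two-trees : 4 ≤ m → Σ (Tree N) λ T₁ → Σ (Tree N) λ T₂ →
      PhyloTree T₁ × PhyloTree T₂ ×
      DisplaysAll T₁ (chosen τ f) × DisplaysAll T₂ (chosen τ f) × ¬ (T₁ ≅ T₂)
    two-trees 4≤m with g , 2≤ ← crowded-side 4≤m =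
      Build.tree resolvedEverywhere , Build.tree (unresolvedAt g) ,
      Build.tree-phylo resolvedEverywhere , Build.tree-phylo (unresolvedAt g) ,
      Build.tree-displays resolvedEverywhere , Build.tree-displays (unresolvedAt g) ,
      λ T₁≅T₂ → unresolvedAt-¬binary g 2≤ (≅-Binary T₁≅T₂ resolved-binary)

part-ii : Part-ii
part-ii (suc (suc m)) (s≤s (s≤s 4≤m)) =
  τ , (Allₚ.tabulate⁺ ∣pairSet∣≡3 , Uniqueₚ.tabulate⁺ pairSet-injective) , length-tabulate pairSet ,
  (subst (0 <_) (sym (length-tabulate pairSet)) (≤-trans (s≤s z≤n) 4≤m) ,
   λ f → let open Build f resolvedEverywhere in tree , tree-phylo , tree-displays) ,
  λ f → two-trees f 4≤m
  where open PairStar m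

proposition1 : Part-i × Part-ii
proposition1 = part-i , part-ii
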